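{- For every finite simple graph $G$, the set $\mathrm{diadem}(G)$ is a critical set, i.e. $d(\mathrm{diadem}(G)) = d(G)$.
   Context: For a finite simple graph $G$ and $X\subseteq V(G)$, $N(X)=\{v\in V(G): v \text{ is adjacent to some vertex of } X\}$. The difference of $X$ is $d(X)=|X|-|N(X)|$, and the critical difference is $d(G)=\max\{d(X): X\subseteq V(G)\}$. A set $X\subseteq V(G)$ is critical if $d(X)=d(G)$. A set is independent if no two of its vertices are adjacent. An independent set $A$ is a critical independent set if $d(A)=\max\{d(I): I \text{ independent in } G\}$ (this maximum equals $d(G)$). $\mathrm{diadem}(G)$ is the union of all critical independent sets of $G$. -}

module Defs where

open import Data.Nat using (ℕ; zero; suc)
open import Data.Bool using (Bool; true; false; _∧_; not)
open import Data.Fin using (Fin)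
open import Data.Vec using (Vec; []; _∷_; tabulate; lookup)
open import Data.List using (List; []; _∷_; map; _++_; allFin; foldr; filterᵇ)
open import Data.Bool.ListAction using (any; all)
open import Relation.Nullary.Decidable using (⌊_⌋)
open import Data.Fin.Subset using (Subset; ∣_∣; ⋃; ⊥)
open import Data.Integer using (ℤ; +_; _-_; _⊔_; _≟_)
open import Relation.Binary.PropositionalEquality using (_≡_)

record Graph (n : ℕ) : Set where
  field
    adj    : Fin n → Fin n → Bool
    sym    : ∀ u v → adj u v ≡ adj v u
    irrefl : ∀ v → adj v v ≡ false
open Graph public

allSubsets : (n : ℕ) → List (Subset n)
allSubsets zero    = [] ∷ []
allSubsets (suc n) = map (false ∷_) (allSubsets n) ++ map (true ∷_) (allSubsets n)

module _ {n : ℕ} (G : Graph n) where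

  N : Subset n → Subset n
  N X = tabulate λ v → any (λ u → lookup X u ∧ adj G u v) (allFin n)

  d : Subset n → ℤ
  d X = + ∣ X ∣ - + ∣ N X ∣

  independent : Subset n → Bool
  independent X = all (λ u → all (λ v → not (lookup X u ∧ lookup X v ∧ adj G u v)) (allFin n)) (allFin n)

  maxOver : List (Subset n) → ℤ
  maxOver = foldr (λ X m → d X ⊔ m) (+ 0)

  -- critical difference d(G) = max { d(X) : X ⊆ V(G) }
  -- (the empty set has difference 0, so starting the fold at 0 is harmless)
  dG : ℤ
  dG = maxOver (allSubsets n)

  dIndep : ℤ
  dIndep = maxOver (filterᵇ independent (allSubsets n))

  isCriticalIndependent : Subset n → Bool
  isCriticalIndependent A = independent A ∧ ⌊ d A ≟ dIndep ⌋

  diadem : Subset n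
  diadem = ⋃ (filterᵇ isCriticalIndependent (allSubsets n))

  Critical : Subset n → Set
  Critical X = d X ≡ dG

-- The difference d is supermodular: |X| + |Y| = |X ∪ Y| + |X ∩ Y|, while
-- N(X ∪ Y) = N(X) ∪ N(Y) and N(X ∩ Y) ⊆ N(X) ∩ N(Y).  Hence if X and Y are
-- critical, d(X ∪ Y) ≥ d(X) + d(Y) - d(X ∩ Y) ≥ d(G), so the union of a nonempty
-- family of critical sets is critical.  Every critical independent set is
-- critical, because X − N(X) is independent with d(X − N(X)) ≥ d(X), so the
-- independent maximum equals d(G).  A critical independent set exists, hence
-- the diadem is a nonempty union of critical sets.
module Submission where

open import Defs
open import Data.Nat using (ℕ)

import Data.Nat as ℕ
import Data.Nat.Properties as ℕ
open import Data.Bool using (Bool; true; false; not; _∧_; T; T?)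
open import Data.Bool.ListAction using (all)
open import Data.Bool.Properties using (T-≡; T-∧)
open import Data.Fin using (Fin)
open import Data.Vec using ([]; _∷_; tabulate; lookup; here; there)
open import Data.Vec.Properties using (lookup∘tabulate; []=⇒lookup; lookup⇒[]=)
open import Data.List using (List; []; _∷_; map; allFin; filterᵇ)
open import Data.List.Membership.Propositional using (lose) renaming (_∈_ to _∈ˡ_)
open import Data.List.Membership.Propositional.Properties using (∈-map⁺; ∈-++⁺ˡ; ∈-++⁺ʳ; ∈-filter⁺; ∈-filter⁻; ∈-allFin)
open import Data.List.Relation.Unary.Any using (here; there; satisfied)
open import Data.List.Relation.Unary.Any.Properties using (any⁺; any⁻)
open import Data.List.Relation.Unary.All as All using (All; []; _∷_)
open import Data.List.Relation.Unary.All.Properties using (all⁻; all-filter)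
open import Data.Fin.Subset using (Subset; inside; outside; _∈_; _∉_; _⊆_; ∣_∣; ⊥; ⋃; _∪_; _∩_; _─_)
open import Data.Fin.Subset.Properties
  using (∣⊥∣≡0; ∉⊥; Empty-unique; ∩-comm; ∪-identityʳ; p⊆q⇒∣p∣≤∣q∣; p∩q⊆p; p∩q⊆q; x∈p∩q⁺; x∈p∪q⁺; x∈p∪q⁻; p─q⊆p; x∈p∧x∉q⇒x∈p─q)
open import Data.Integer using (ℤ; +_; 0ℤ; _+_; _-_; -_; _⊖_; _≤_; _≟_)
open import Data.Integer.Properties
  using (≤-refl; ≤-trans; ≤-antisym; +-monoˡ-≤; +-monoʳ-≤; [+m]-[+n]≡m⊖n; +-cancelˡ-⊖; ⊖-monoˡ-≤; pos-+; i≤i⊔j; i≤j⇒i≤k⊔j; ⊔-lub; ⊔-sel; module ≤-Reasoning)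
open import Data.Integer.Tactic.RingSolver using (solve-∀)
open import Data.Product using (∃-syntax; _×_; _,_; proj₁; proj₂)
open import Data.Sum using (_⊎_; inj₁; inj₂)
open import Function using (_∘_; Equivalence)
open import Relation.Nullary using (¬_)
open import Relation.Nullary.Decidable using (toWitness; fromWitness)
open import Relation.Binary.PropositionalEquality using (_≡_; refl; cong; cong₂; subst; trans)
import Relation.Binary.PropositionalEquality as ≡

∣p∪q∣+∣p∩q∣≡∣p∣+∣q∣ : ∀ {n} (p q : Subset n) → ∣ p ∪ q ∣ ℕ.+ ∣ p ∩ q ∣ ≡ ∣ p ∣ ℕ.+ ∣ q ∣
∣p∪q∣+∣p∩q∣≡∣p∣+∣q∣ []            []            = refl
∣p∪q∣+∣p∩q∣≡∣p∣+∣q∣ (inside  ∷ p) (inside  ∷ q) = cong ℕ.suc (begin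
  ∣ p ∪ q ∣ ℕ.+ ℕ.suc ∣ p ∩ q ∣ ≡⟨ ℕ.+-suc _ _ ⟩
  ℕ.suc (∣ p ∪ q ∣ ℕ.+ ∣ p ∩ q ∣) ≡⟨ cong ℕ.suc (∣p∪q∣+∣p∩q∣≡∣p∣+∣q∣ p q) ⟩
  ℕ.suc (∣ p ∣ ℕ.+ ∣ q ∣)       ≡⟨ ℕ.+-suc _ _ ⟨
  ∣ p ∣ ℕ.+ ℕ.suc ∣ q ∣         ∎)
  where open ≡.≡-Reasoning
∣p∪q∣+∣p∩q∣≡∣p∣+∣q∣ (inside  ∷ p) (outside ∷ q) = cong ℕ.suc (∣p∪q∣+∣p∩q∣≡∣p∣+∣q∣ p q)
∣p∪q∣+∣p∩q∣≡∣p∣+∣q∣ (outside ∷ p) (inside  ∷ q) =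
  trans (cong ℕ.suc (∣p∪q∣+∣p∩q∣≡∣p∣+∣q∣ p q)) (≡.sym (ℕ.+-suc _ _))
∣p∪q∣+∣p∩q∣≡∣p∣+∣q∣ (outside ∷ p) (outside ∷ q) = ∣p∪q∣+∣p∩q∣≡∣p∣+∣q∣ p q

∣p∩q∣+∣p─q∣≡∣p∣ : ∀ {n} (p q : Subset n) → ∣ p ∩ q ∣ ℕ.+ ∣ p ─ q ∣ ≡ ∣ p ∣
∣p∩q∣+∣p─q∣≡∣p∣ []            []            = refl
∣p∩q∣+∣p─q∣≡∣p∣ (inside  ∷ p) (inside  ∷ q) = cong ℕ.suc (∣p∩q∣+∣p─q∣≡∣p∣ p q)
∣p∩q∣+∣p─q∣≡∣p∣ (inside  ∷ p) (outside ∷ q) = trans (ℕ.+-suc _ _) (cong ℕ.suc (∣p∩q∣+∣p─q∣≡∣p∣ p q))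
∣p∩q∣+∣p─q∣≡∣p∣ (outside ∷ p) (inside  ∷ q) = ∣p∩q∣+∣p─q∣≡∣p∣ p q
∣p∩q∣+∣p─q∣≡∣p∣ (outside ∷ p) (outside ∷ q) = ∣p∩q∣+∣p─q∣≡∣p∣ p q

x∈p─q⇒x∉q : ∀ {n} {x : Fin n} (p q : Subset n) → x ∈ p ─ q → x ∉ q
x∈p─q⇒x∉q (inside ∷ p) (outside ∷ q) here        ()
x∈p─q⇒x∉q (_      ∷ p) (_       ∷ q) (there x∈) (there x∈q) = x∈p─q⇒x∉q p q x∈ x∈q

∈⇒T-lookup : ∀ {n} {X : Subset n} {x} → x ∈ X → T (lookup X x)
∈⇒T-lookup = Equivalence.from T-≡ ∘ []=⇒lookup

T-lookup⇒∈ : ∀ {n} {X : Subset n} {x} → T (lookup X x) → x ∈ X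
T-lookup⇒∈ = lookup⇒[]= _ _ ∘ Equivalence.to T-≡

∈-tabulate⁻ : ∀ {n} {f : Fin n → Bool} {x} → x ∈ tabulate f → T (f x)
∈-tabulate⁻ {f = f} {x} = subst T (lookup∘tabulate f x) ∘ ∈⇒T-lookup

∈-tabulate⁺ : ∀ {n} {f : Fin n → Bool} {x} → T (f x) → x ∈ tabulate f
∈-tabulate⁺ {f = f} {x} = T-lookup⇒∈ ∘ subst T (≡.sym (lookup∘tabulate f x))

∈-allSubsets : ∀ {n} (X : Subset n) → X ∈ˡ allSubsets n
∈-allSubsets []                    = here refl
∈-allSubsets {ℕ.suc n} (outside ∷ X) = ∈-++⁺ˡ (∈-map⁺ (outside ∷_) (∈-allSubsets X))
∈-allSubsets {ℕ.suc n} (inside  ∷ X) =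
  ∈-++⁺ʳ (map (outside ∷_) (allSubsets n)) (∈-map⁺ (inside ∷_) (∈-allSubsets X))

[+m]-[+n]≤[+o]-[+p] : ∀ m n o p → m ℕ.+ p ℕ.≤ o ℕ.+ n → + m - + n ≤ + o - + p
[+m]-[+n]≤[+o]-[+p] m n o p m+p≤o+n = begin
  + m - + n                   ≡⟨ [+m]-[+n]≡m⊖n m n ⟩
  m ⊖ n                       ≡⟨ +-cancelˡ-⊖ p m n ⟨
  (p ℕ.+ m) ⊖ (p ℕ.+ n)       ≤⟨ ⊖-monoˡ-≤ (p ℕ.+ n) (subst (ℕ._≤ o ℕ.+ n) (ℕ.+-comm m p) m+p≤o+n) ⟩
  (o ℕ.+ n) ⊖ (p ℕ.+ n)       ≡⟨ cong₂ _⊖_ (ℕ.+-comm o n) (ℕ.+-comm p n) ⟩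
  (n ℕ.+ o) ⊖ (n ℕ.+ p)       ≡⟨ +-cancelˡ-⊖ n o p ⟩
  o ⊖ p                       ≡⟨ [+m]-[+n]≡m⊖n o p ⟨
  + o - + p                   ∎
  where open ≤-Reasoning

[+m]-[+n]+[+o]-[+p] : ∀ m n o p → (+ m - + n) + (+ o - + p) ≡ + (m ℕ.+ o) - + (n ℕ.+ p)
[+m]-[+n]+[+o]-[+p] m n o p rewrite pos-+ m o | pos-+ n p = regroup (+ m) (+ n) (+ o) (+ p)
  where
  regroup : ∀ (i j k l : ℤ) → (i - j) + (k - l) ≡ (i + k) - (j + l)
  regroup = solve-∀

+-cancelʳ-≤ : ∀ {i j} k → i + k ≤ j + k → i ≤ j
+-cancelʳ-≤ {i} {j} k i+k≤j+k = begin
  i             ≡⟨ i+k-k≡i i k ⟨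
  (i + k) - k   ≤⟨ +-monoˡ-≤ (- k) i+k≤j+k ⟩
  (j + k) - k   ≡⟨ i+k-k≡i j k ⟩
  j             ∎
  where
  open ≤-Reasoning
  i+k-k≡i : ∀ (i k : ℤ) → (i + k) - k ≡ i
  i+k-k≡i = solve-∀

module _ {n : ℕ} (G : Graph n) where

  ∈N⁺ : ∀ {X u v} → u ∈ X → T (adj G u v) → v ∈ N G X
  ∈N⁺ {X} {u} {v} u∈X uv = ∈-tabulate⁺ (any⁺ (λ w → lookup X w ∧ adj G w v)
    (lose (∈-allFin u) (Equivalence.from T-∧ (∈⇒T-lookup u∈X , uv))))

  ∈N⁻ : ∀ {X v} → v ∈ N G X → ∃[ u ] u ∈ X × T (adj G u v)
  ∈N⁻ v∈NX with satisfied (any⁻ _ (allFin n) (∈-tabulate⁻ v∈NX))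
  ... | u , Xu∧uv with Equivalence.to T-∧ Xu∧uv
  ...   | Xu , uv = u , T-lookup⇒∈ Xu , uv

  N-mono : ∀ {X Y} → X ⊆ Y → N G X ⊆ N G Y
  N-mono X⊆Y v∈NX with ∈N⁻ v∈NX
  ... | u , u∈X , uv = ∈N⁺ (X⊆Y u∈X) uv

  N-∪ : ∀ X Y → N G (X ∪ Y) ⊆ N G X ∪ N G Y
  N-∪ X Y v∈N∪ with ∈N⁻ v∈N∪
  ... | u , u∈X∪Y , uv with x∈p∪q⁻ X Y u∈X∪Y
  ...   | inj₁ u∈X = x∈p∪q⁺ (inj₁ (∈N⁺ u∈X uv))
  ...   | inj₂ u∈Y = x∈p∪q⁺ (inj₂ (∈N⁺ u∈Y uv))

  N-∩ : ∀ X Y → N G (X ∩ Y) ⊆ N G X ∩ N G Y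
  N-∩ X Y v∈N∩ = x∈p∩q⁺ (N-mono (p∩q⊆p X Y) v∈N∩ , N-mono (p∩q⊆q X Y) v∈N∩)

  N-⊥ : N G ⊥ ≡ ⊥
  N-⊥ = Empty-unique λ (v , v∈N⊥) → ∉⊥ (proj₁ (proj₂ (∈N⁻ v∈N⊥)))

  independent⁺ : ∀ X → (∀ {u v} → u ∈ X → v ∈ X → ¬ T (adj G u v)) → T (independent G X)
  independent⁺ X no-edges =
    all⁻ (λ u → all (no-edge? u) (allFin n))
      (All.universal (λ u → all⁻ (no-edge? u) (All.universal (no-edge u) (allFin n))) (allFin n))
    where
    no-edge? : Fin n → Fin n → Bool
    no-edge? u v = not (lookup X u ∧ lookup X v ∧ adj G u v)
    no-edge : ∀ u v → T (no-edge? u v)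
    no-edge u v with lookup X u in Xu | lookup X v in Xv | adj G u v in uv
    ... | false | _     | _     = _
    ... | true  | false | _     = _
    ... | true  | true  | false = _
    ... | true  | true  | true  =
      no-edges (lookup⇒[]= u X Xu) (lookup⇒[]= v X Xv) (subst T (≡.sym uv) _)

  ∣N[X∪Y]∣+∣N[X∩Y]∣≤∣NX∣+∣NY∣ : ∀ X Y → ∣ N G (X ∪ Y) ∣ ℕ.+ ∣ N G (X ∩ Y) ∣ ℕ.≤ ∣ N G X ∣ ℕ.+ ∣ N G Y ∣
  ∣N[X∪Y]∣+∣N[X∩Y]∣≤∣NX∣+∣NY∣ X Y = begin
    ∣ N G (X ∪ Y) ∣ ℕ.+ ∣ N G (X ∩ Y) ∣     ≤⟨ ℕ.+-mono-≤ (p⊆q⇒∣p∣≤∣q∣ (N-∪ X Y)) (p⊆q⇒∣p∣≤∣q∣ (N-∩ X Y)) ⟩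
    ∣ N G X ∪ N G Y ∣ ℕ.+ ∣ N G X ∩ N G Y ∣ ≡⟨ ∣p∪q∣+∣p∩q∣≡∣p∣+∣q∣ (N G X) (N G Y) ⟩
    ∣ N G X ∣ ℕ.+ ∣ N G Y ∣                 ∎
    where open ℕ.≤-Reasoning

  d-supermodular : ∀ X Y → d G X + d G Y ≤ d G (X ∪ Y) + d G (X ∩ Y)
  d-supermodular X Y = begin
    d G X + d G Y
      ≡⟨ [+m]-[+n]+[+o]-[+p] (∣ X ∣) (∣ N G X ∣) (∣ Y ∣) (∣ N G Y ∣) ⟩
    + (∣ X ∣ ℕ.+ ∣ Y ∣) - + (∣ N G X ∣ ℕ.+ ∣ N G Y ∣)
      ≤⟨ [+m]-[+n]≤[+o]-[+p] (∣ X ∣ ℕ.+ ∣ Y ∣) (∣ N G X ∣ ℕ.+ ∣ N G Y ∣)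
           (∣ X ∪ Y ∣ ℕ.+ ∣ X ∩ Y ∣) (∣ N G (X ∪ Y) ∣ ℕ.+ ∣ N G (X ∩ Y) ∣)
           (ℕ.+-mono-≤ (ℕ.≤-reflexive (≡.sym (∣p∪q∣+∣p∩q∣≡∣p∣+∣q∣ X Y))) (∣N[X∪Y]∣+∣N[X∩Y]∣≤∣NX∣+∣NY∣ X Y)) ⟩
    + (∣ X ∪ Y ∣ ℕ.+ ∣ X ∩ Y ∣) - + (∣ N G (X ∪ Y) ∣ ℕ.+ ∣ N G (X ∩ Y) ∣)
      ≡⟨ [+m]-[+n]+[+o]-[+p] (∣ X ∪ Y ∣) (∣ N G (X ∪ Y) ∣) (∣ X ∩ Y ∣) (∣ N G (X ∩ Y) ∣) ⟨
    d G (X ∪ Y) + d G (X ∩ Y) ∎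
    where open ≤-Reasoning

  X─NX-independent : ∀ X → T (independent G (X ─ N G X))
  X─NX-independent X = independent⁺ (X ─ N G X) λ u∈I v∈I uv →
    x∈p─q⇒x∉q X (N G X) v∈I (∈N⁺ (p─q⊆p X (N G X) u∈I) uv)

  N[X─NX]⊆NX─X : ∀ X → N G (X ─ N G X) ⊆ N G X ─ X
  N[X─NX]⊆NX─X X {v} v∈NI with ∈N⁻ v∈NI
  ... | u , u∈I , uv = x∈p∧x∉q⇒x∈p─q (∈N⁺ (p─q⊆p X (N G X) u∈I) uv)
    λ v∈X → x∈p─q⇒x∉q X (N G X) u∈I (∈N⁺ v∈X (subst T (Graph.sym G u v) uv))

  d≤d[X─NX] : ∀ X → d G X ≤ d G (X ─ N G X)
  d≤d[X─NX] X = [+m]-[+n]≤[+o]-[+p] (∣ X ∣) (∣ N G X ∣) (∣ I ∣) (∣ N G I ∣) (begin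
    ∣ X ∣ ℕ.+ ∣ N G I ∣                        ≡⟨ cong (ℕ._+ ∣ N G I ∣) (∣p∩q∣+∣p─q∣≡∣p∣ X (N G X)) ⟨
    (∣ X ∩ N G X ∣ ℕ.+ ∣ I ∣) ℕ.+ ∣ N G I ∣    ≤⟨ ℕ.+-monoʳ-≤ _ (p⊆q⇒∣p∣≤∣q∣ (N[X─NX]⊆NX─X X)) ⟩
    (∣ X ∩ N G X ∣ ℕ.+ ∣ I ∣) ℕ.+ ∣ N G X ─ X ∣ ≡⟨ cong (λ k → (k ℕ.+ ∣ I ∣) ℕ.+ ∣ N G X ─ X ∣) (cong ∣_∣ (∩-comm X (N G X))) ⟩
    (∣ N G X ∩ X ∣ ℕ.+ ∣ I ∣) ℕ.+ ∣ N G X ─ X ∣ ≡⟨ cong (ℕ._+ ∣ N G X ─ X ∣) (ℕ.+-comm _ ∣ I ∣) ⟩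
    (∣ I ∣ ℕ.+ ∣ N G X ∩ X ∣) ℕ.+ ∣ N G X ─ X ∣ ≡⟨ ℕ.+-assoc (∣ I ∣) _ _ ⟩
    ∣ I ∣ ℕ.+ (∣ N G X ∩ X ∣ ℕ.+ ∣ N G X ─ X ∣) ≡⟨ cong (∣ I ∣ ℕ.+_) (∣p∩q∣+∣p─q∣≡∣p∣ (N G X) X) ⟩
    ∣ I ∣ ℕ.+ ∣ N G X ∣                        ∎)
    where
    open ℕ.≤-Reasoning
    I : Subset n
    I = X ─ N G X

  d-⊥ : d G ⊥ ≡ 0ℤ
  d-⊥ rewrite N-⊥ | ∣⊥∣≡0 n = refl

  d≤maxOver : ∀ {X l} → X ∈ˡ l → d G X ≤ maxOver G l
  d≤maxOver {l = Y ∷ l} (here refl) = i≤i⊔j (d G Y) (maxOver G l)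
  d≤maxOver {l = Y ∷ l} (there X∈l) = i≤j⇒i≤k⊔j (d G Y) (d≤maxOver X∈l)

  maxOver-lub : ∀ l {m} → 0ℤ ≤ m → (∀ {X} → X ∈ˡ l → d G X ≤ m) → maxOver G l ≤ m
  maxOver-lub []      0≤m _   = 0≤m
  maxOver-lub (Y ∷ l) 0≤m d≤m = ⊔-lub (d≤m (here refl)) (maxOver-lub l 0≤m (d≤m ∘ there))

  0≤maxOver : ∀ l → 0ℤ ≤ maxOver G l
  0≤maxOver []      = ≤-refl
  0≤maxOver (Y ∷ l) = i≤j⇒i≤k⊔j (d G Y) (0≤maxOver l)

  -- The fold starts from 0, so the maximum may be that seed rather than a value of d.
  maxOver-attained : ∀ l → maxOver G l ≡ 0ℤ ⊎ ∃[ X ] X ∈ˡ l × d G X ≡ maxOver G l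
  maxOver-attained []      = inj₁ refl
  maxOver-attained (Y ∷ l) with ⊔-sel (d G Y) (maxOver G l) | maxOver-attained l
  ... | inj₁ max≡dY | _                       = inj₂ (Y , here refl , ≡.sym max≡dY)
  ... | inj₂ max≡m  | inj₁ m≡0                = inj₁ (trans max≡m m≡0)
  ... | inj₂ max≡m  | inj₂ (X , X∈l , dX≡m)   = inj₂ (X , there X∈l , trans dX≡m (≡.sym max≡m))

  d≤dG : ∀ X → d G X ≤ dG G
  d≤dG X = d≤maxOver (∈-allSubsets X)

  independentSets : List (Subset n)
  independentSets = filterᵇ (independent G) (allSubsets n)

  ∈-independentSets : ∀ X → T (independent G X) → X ∈ˡ independentSets
  ∈-independentSets X = ∈-filter⁺ (T? ∘ independent G) (∈-allSubsets X)

  dG≡dIndep : dG G ≡ dIndep G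
  dG≡dIndep = ≤-antisym
    (maxOver-lub (allSubsets n) (0≤maxOver independentSets) λ {X} _ →
      ≤-trans (d≤d[X─NX] X) (d≤maxOver (∈-independentSets (X ─ N G X) (X─NX-independent X))))
    (maxOver-lub independentSets (0≤maxOver (allSubsets n)) λ {X} _ → d≤dG X)

  Critical-∪ : ∀ X Y → Critical G X → Critical G Y → Critical G (X ∪ Y)
  Critical-∪ X Y dX≡dG dY≡dG = ≤-antisym (d≤dG (X ∪ Y)) (+-cancelʳ-≤ (dG G) (begin
    dG G + dG G               ≡⟨ cong₂ _+_ dX≡dG dY≡dG ⟨
    d G X + d G Y             ≤⟨ d-supermodular X Y ⟩
    d G (X ∪ Y) + d G (X ∩ Y) ≤⟨ +-monoʳ-≤ (d G (X ∪ Y)) (d≤dG (X ∩ Y)) ⟩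
    d G (X ∪ Y) + dG G        ∎))
    where open ≤-Reasoning

  -- The membership proof only witnesses that l is nonempty; ⋃ [] = ⊥ need not be critical.
  Critical-⋃ : ∀ {l X} → All (Critical G) l → X ∈ˡ l → Critical G (⋃ l)
  Critical-⋃ {Y ∷ []} (cY ∷ [])         _ = trans (cong (d G) (∪-identityʳ Y)) cY
  Critical-⋃ {Y ∷ l} (cY ∷ cs@(_ ∷ _)) _ = Critical-∪ Y (⋃ l) cY (Critical-⋃ cs (here refl))

  isCriticalIndependent⁺ : ∀ A → T (independent G A) → d G A ≡ dIndep G → T (isCriticalIndependent G A)
  isCriticalIndependent⁺ A indep dA≡ = Equivalence.from T-∧ (indep , fromWitness dA≡)

  criticalIndependent⇒critical : ∀ A → T (isCriticalIndependent G A) → Critical G A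
  criticalIndependent⇒critical A ci =
    trans (toWitness {a? = d G A ≟ dIndep G} (proj₂ (Equivalence.to (T-∧ {independent G A}) ci))) (≡.sym dG≡dIndep)

  criticalIndependent-exists : ∃[ A ] T (isCriticalIndependent G A)
  criticalIndependent-exists with maxOver-attained independentSets
  ... | inj₁ dIndep≡0 =
    ⊥ , isCriticalIndependent⁺ ⊥ (independent⁺ ⊥ (λ u∈⊥ _ _ → ∉⊥ u∈⊥)) (trans d-⊥ (≡.sym dIndep≡0))
  ... | inj₂ (A , A∈ , dA≡) =
    A , isCriticalIndependent⁺ A (proj₂ (∈-filter⁻ (T? ∘ independent G) {xs = allSubsets n} A∈)) dA≡

  diadem-critical : Critical G (diadem G)
  diadem-critical with criticalIndependent-exists
  ... | A , A-ci = Critical-⋃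
    (All.map (λ {A} → criticalIndependent⇒critical A) (all-filter (T? ∘ isCriticalIndependent G) (allSubsets n)))
    (∈-filter⁺ (T? ∘ isCriticalIndependent G) (∈-allSubsets A) A-ci)

corollary2p2 : ∀ (n : ℕ) (G : Graph n) → Critical G (diadem G)
corollary2p2 n G = diadem-critical G
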